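{- Let $H$ be a finite digraph possibly with loops, $D$ a finite $H$-colored digraph without loops and without isolated vertices, and $\xi=\{C_1,\dots,C_k\}$ ($k\ge2$) a partition of $V(H)$ such that for every $i$ the set $A_i=\{a\in A(D):c(a)\in C_i\}$ is nonempty and $G_i=D[A_i]$ is transitive by $H$-paths. Let $r\in\{1,\dots,k\}$. Then: (1) there is no infinite sequence of vertices $(x_0,x_1,x_2,\dots)$ such that for every $i\ge0$ there exists an $x_ix_{i+1}$-$H$-path in $G_r$ and there exists no $x_{i+1}x_i$-$H$-path in $G_r$; (2) there exists $x_0\in V(G_r)$ such that $\{x_0\}$ is an $H$-semikernel of $G_r$.
   Context: Paths and walks are directed; a path has pairwise distinct vertices. $D$ is $H$-colored if it has an arc coloring $c:A(D)\to V(H)$. A walk $(v_0,\dots,v_n)$ is an $H$-walk if $(c(v_0,v_1),\dots,c(v_{n-1},v_n))$ is a walk in $H$ (a single arc is an $H$-walk); an $H$-path is a path that is an $H$-walk. $D[A]$ for an arc set $A$ is the subdigraph with arc set $A$ and vertex set the ends of arcs in $A$. A subdigraph $G$ is transitive by $H$-paths if an $xy$-$H$-path contained in $G$ and a $yz$-$H$-path contained in $G$ imply an $xz$-$H$-path contained in $G$. For an $H$-colored digraph $G$, a set $S\subseteq V(G)$ is an $H$-semikernel of $G$ if (i) there is no $H$-path in $G$ between two distinct vertices of $S$, and (ii) for every $z\in V(G)\setminus S$, if there is an $H$-path in $G$ from a vertex of $S$ to $z$, then there is an $H$-path in $G$ from $z$ to a vertex of $S$. -}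

module Defs where

open import Data.Nat using (ℕ)
open import Data.Fin using (Fin)
open import Data.Bool using (Bool; true; false)
open import Data.List using (List; []; _∷_; _++_; [_])
open import Data.List.Relation.Unary.Unique.Propositional using (Unique)
open import Data.Product using (Σ; ∃; _×_)
open import Data.Sum using (_⊎_)
open import Data.Unit using (⊤)
open import Relation.Nullary using (¬_)
open import Relation.Binary.PropositionalEquality using (_≡_; _≢_)

-- A finite digraph H (loops allowed) on vertex set Fin h is an adjacency
-- relation HA : Fin h → Fin h → Bool (arc u→v iff HA u v ≡ true).
-- A finite digraph D on Fin n is DA : Fin n → Fin n → Bool.
-- An H-colouring of D is c : Fin n → Fin n → Fin h; only its values on
-- arcs (DA u v ≡ true) are ever used.

module _ {n : ℕ} where

  Consec : (Fin n → Fin n → Set) → List (Fin n) → Set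
  Consec R []             = ⊤
  Consec R (x ∷ [])       = ⊤
  Consec R (x ∷ y ∷ xs)   = R x y × Consec R (y ∷ xs)

  ColourWalk : {h : ℕ} → (Fin h → Fin h → Bool) → (Fin n → Fin n → Fin h) →
               List (Fin n) → Set
  ColourWalk HA c []               = ⊤
  ColourWalk HA c (x ∷ [])         = ⊤
  ColourWalk HA c (x ∷ y ∷ [])     = ⊤
  ColourWalk HA c (x ∷ y ∷ z ∷ xs) = HA (c x y) (c y z) ≡ true × ColourWalk HA c (y ∷ z ∷ xs)

  -- an xy-H-path (with at least one arc) all of whose arcs lie in the arc set G
  -- (G u v: (u,v) is an arc of the subdigraph); vertices pairwise distinct.
  HPathIn : {h : ℕ} → (Fin h → Fin h → Bool) → (Fin n → Fin n → Fin h) →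
            (Fin n → Fin n → Set) → Fin n → Fin n → Set
  HPathIn HA c G x y =
    Σ (List (Fin n)) λ mid →
      Unique (x ∷ (mid ++ [ y ])) ×
      Consec G (x ∷ (mid ++ [ y ])) ×
      ColourWalk HA c (x ∷ (mid ++ [ y ]))

  VertexOf : (Fin n → Fin n → Set) → Fin n → Set
  VertexOf G v = ∃ λ u → G v u ⊎ G u v

  TransitiveByHPaths : {h : ℕ} → (Fin h → Fin h → Bool) → (Fin n → Fin n → Fin h) →
                       (Fin n → Fin n → Set) → Set
  TransitiveByHPaths HA c G =
    ∀ x y z → x ≢ z → HPathIn HA c G x y → HPathIn HA c G y z → HPathIn HA c G x z

  IsHSemikernel : {h : ℕ} → (Fin h → Fin h → Bool) → (Fin n → Fin n → Fin h) →
                  (Fin n → Fin n → Set) → (Fin n → Set) → Set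
  IsHSemikernel HA c G S =
    (∀ v → S v → VertexOf G v) ×
    (∀ x y → S x → S y → x ≢ y → ¬ HPathIn HA c G x y) ×
    (∀ z → VertexOf G z → ¬ S z →
       (∃ λ s → S s × HPathIn HA c G s z) →
       (∃ λ s → S s × HPathIn HA c G z s))

-- the arc set A_i = {a ∈ A(D) : c(a) ∈ C_i}, where the partition ξ of V(H)
-- into classes C_1..C_k is given by cls : Fin h → Fin k (C_i = cls⁻¹(i)).
ArcClass : {h n k : ℕ} → (Fin n → Fin n → Bool) → (Fin n → Fin n → Fin h) →
           (Fin h → Fin k) → Fin k → Fin n → Fin n → Set
ArcClass DA c cls i u v = DA u v ≡ true × cls (c u v) ≡ i

-- The strict part x ≺ y of "there is an xy-H-path in G_r" (a path one way but
-- not back) is irreflexive, since H-paths have distinct ends, and transitive,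
-- since G_r is transitive by H-paths; so it is a strict order on the finite set
-- V(D). A strict order on a finite set has no infinite ascending chain (by
-- pigeonhole a chain repeats a vertex), which is (1). As H-paths are found by a
-- finite search, ≺ is decidable, and a ≺-maximal vertex x₀ of G_r exists:
-- otherwise one could climb forever. Maximality says every H-path leaving x₀
-- is answered by one returning to x₀, so {x₀} is an H-semikernel.
module Submission where

open import Defs
open import Data.Nat as ℕ using (ℕ; zero; suc; _≥_; _≤_; z≤n; s≤s)
open import Data.Nat.Properties using (≤-trans; n≤1+n; n<1+n; m<1+n⇒m<n∨m≡n)
open import Data.Fin using (Fin; zero; suc; toℕ) renaming (_≟_ to _≟ᶠ_)
open import Data.Fin.Properties using (any?; all?; pigeonhole; injective⇒≤)
open import Data.Bool using (Bool; true; false)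
open import Data.Bool.Properties using () renaming (_≟_ to _≟ᵇ_)
open import Data.List using (List; []; _∷_; _++_; [_]; length; lookup)
open import Data.List.Properties using (length-++-≤ˡ)
open import Data.List.Membership.Propositional.Properties using (∈-lookup)
open import Data.List.Relation.Unary.All as All using ([]; _∷_)
open import Data.List.Relation.Unary.All.Properties using (++⁻ʳ)
open import Data.List.Relation.Unary.Unique.Propositional using (Unique; []; _∷_)
import Data.List.Relation.Unary.Unique.DecPropositional as UniqueDec
open import Data.Product using (Σ; ∃; _×_; _,_; proj₁; proj₂)
open import Data.Sum using (_⊎_; inj₁; inj₂)
open import Data.Unit using (tt)
open import Data.Empty using (⊥-elim)
open import Function.Definitions using (Injective)
open import Relation.Nullary using (¬_; contradiction)
open import Relation.Nullary.Decidable using (Dec; yes; no; ¬?; _×-dec_; _⊎-dec_; decidable-stable)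
open import Relation.Unary as U using (Pred)
open import Relation.Binary using (Rel; Transitive; Decidable)
open import Relation.Binary.PropositionalEquality using (_≡_; _≢_; refl; sym; cong; subst)

lookup-injective : ∀ {a} {A : Set a} {xs : List A} → Unique xs → Injective _≡_ _≡_ (lookup xs)
lookup-injective (_  ∷ _)   {zero}  {zero}  _  = refl
lookup-injective (x∉ ∷ _)   {zero}  {suc j} eq = contradiction eq (All.lookup x∉ (∈-lookup j))
lookup-injective (x∉ ∷ _)   {suc i} {zero}  eq = contradiction (sym eq) (All.lookup x∉ (∈-lookup i))
lookup-injective (_  ∷ xs!) {suc i} {suc j} eq = cong suc (lookup-injective xs! eq)

Unique⇒length≤ : ∀ {n} {xs : List (Fin n)} → Unique xs → length xs ≤ n
Unique⇒length≤ xs! = injective⇒≤ (lookup-injective xs!)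

∃-list-length≤? : ∀ {n p} {Q : Pred (List (Fin n)) p} → U.Decidable Q →
                  ∀ m → Dec (∃ λ xs → length xs ≤ m × Q xs)
∃-list-length≤? Q? m with Q? []
... | yes q = yes ([] , z≤n , q)
∃-list-length≤? Q? zero | no ¬q = no λ { ([] , _ , q) → ¬q q }
∃-list-length≤? Q? (suc m) | no ¬q with any? (λ x → ∃-list-length≤? (λ xs → Q? (x ∷ xs)) m)
... | yes (x , xs , len , q) = yes (x ∷ xs , s≤s len , q)
... | no ¬cons = no λ { ([] , _ , q) → ¬q q ; (x ∷ xs , s≤s len , q) → ¬cons (x , xs , len , q) }

module StrictOrderOnFin {n ℓ} {_≺_ : Rel (Fin n) ℓ}
                        (≺-irrefl : ∀ {x} → ¬ x ≺ x) (≺-trans : Transitive _≺_) where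

  Chain : (ℕ → Fin n) → Set ℓ
  Chain x = ∀ i → x i ≺ x (suc i)

  chain-increasing : ∀ {x} → Chain x → ∀ {i j} → i ℕ.< j → x i ≺ x j
  chain-increasing step {j = suc j} i<1+j with m<1+n⇒m<n∨m≡n i<1+j
  ... | inj₁ i<j  = ≺-trans (chain-increasing step i<j) (step j)
  ... | inj₂ refl = step j

  no-infinite-chain : ¬ ∃ Chain
  no-infinite-chain (x , step) with pigeonhole (n<1+n n) (λ i → x (toℕ i))
  ... | i , j , i<j , xᵢ≡xⱼ =
    ≺-irrefl (subst (λ y → x (toℕ i) ≺ y) (sym xᵢ≡xⱼ) (chain-increasing step i<j))

  Maximal : Fin n → Set ℓ
  Maximal x = ∀ y → ¬ x ≺ y

  ∃-maximal : Decidable _≺_ → ∀ {v} {V : Pred (Fin n) v} → U.Decidable V →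
              (∀ {x y} → V x → x ≺ y → V y) → ∃ V → ∃ λ x → V x × Maximal x
  ∃-maximal _≺?_ {V = V} V? V-closed (x₀ , Vx₀)
    with any? (λ x → V? x ×-dec all? (λ y → ¬? (x ≺? y)))
  ... | yes found = found
  ... | no none = ⊥-elim (no-infinite-chain (climb , λ i → proj₁ (proj₂ (ascend (climbFrom i)))))
    where
    ascend : (p : Σ (Fin n) V) → ∃ λ y → proj₁ p ≺ y × V y
    ascend (x , Vx) with any? (x ≺?_)
    ... | yes (y , x≺y) = y , x≺y , V-closed Vx x≺y
    ... | no  ¬step     = contradiction (x , Vx , λ y x≺y → ¬step (y , x≺y)) none

    climbFrom : ℕ → Σ (Fin n) V
    climbFrom zero    = x₀ , Vx₀
    climbFrom (suc i) with ascend (climbFrom i)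
    ... | y , _ , Vy = y , Vy

    climb : ℕ → Fin n
    climb i = proj₁ (climbFrom i)

StrictPart : ∀ {a ℓ} {A : Set a} → Rel A ℓ → Rel A ℓ
StrictPart P x y = P x y × ¬ P y x

module _ {a ℓ} {A : Set a} {P : Rel A ℓ} where

  strictPart? : Decidable P → Decidable (StrictPart P)
  strictPart? P? x y = P? x y ×-dec ¬? (P? y x)

  strictPart-irrefl : (∀ {x} → ¬ P x x) → ∀ {x} → ¬ StrictPart P x x
  strictPart-irrefl P-irrefl (xx , _) = P-irrefl xx

  strictPart-trans : (∀ {x} → ¬ P x x) → (∀ x y z → x ≢ z → P x y → P y z → P x z) →
                     Transitive (StrictPart P)
  strictPart-trans P-irrefl P-trans {x} {y} {z} (xy , ¬yx) (yz , ¬zy) = P-trans x y z x≢z xy yz , ¬zx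
    where
    x≢z : x ≢ z
    x≢z refl = ¬yx yz

    y≢x : y ≢ x
    y≢x refl = P-irrefl xy

    ¬zx : ¬ P z x
    ¬zx zx = ¬yx (P-trans y z x y≢x yz zx)

module _ {n : ℕ} (G : Fin n → Fin n → Set) where

  consec? : Decidable G → U.Decidable (Consec G)
  consec? G? []          = yes tt
  consec? G? (x ∷ [])     = yes tt
  consec? G? (x ∷ y ∷ xs) = G? x y ×-dec consec? G? (y ∷ xs)

  consec⇒last-vertexOf : ∀ x mid {z} → Consec G (x ∷ (mid ++ [ z ])) → VertexOf G z
  consec⇒last-vertexOf x []        (xz , _)   = x , inj₂ xz
  consec⇒last-vertexOf x (y ∷ mid) (_ , arcs) = consec⇒last-vertexOf y mid arcs

module _ {n h : ℕ} (HA : Fin h → Fin h → Bool) (c : Fin n → Fin n → Fin h) where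

  colourWalk? : U.Decidable (ColourWalk HA c)
  colourWalk? []               = yes tt
  colourWalk? (x ∷ [])         = yes tt
  colourWalk? (x ∷ y ∷ [])     = yes tt
  colourWalk? (x ∷ y ∷ z ∷ xs) = (HA (c x y) (c y z) ≟ᵇ true) ×-dec colourWalk? (y ∷ z ∷ xs)

  module _ (G : Fin n → Fin n → Set) where

    hPath-irrefl : ∀ {x} → ¬ HPathIn HA c G x x
    hPath-irrefl (mid , x∉ ∷ _ , _) with ++⁻ʳ mid x∉
    ... | x≢x ∷ [] = x≢x refl

    hPath⇒target-vertexOf : ∀ {x z} → HPathIn HA c G x z → VertexOf G z
    hPath⇒target-vertexOf {x} (mid , _ , arcs , _) = consec⇒last-vertexOf G x mid arcs

    -- The search is finite because a path visits each vertex at most once.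
    hPath? : Decidable G → Decidable (HPathIn HA c G)
    hPath? G? x z with ∃-list-length≤? (λ mid → isHPath? (x ∷ (mid ++ [ z ]))) n
      where
      isHPath? : U.Decidable (λ xs → Unique xs × Consec G xs × ColourWalk HA c xs)
      isHPath? xs = UniqueDec.unique? _≟ᶠ_ xs ×-dec consec? G G? xs ×-dec colourWalk? xs
    ... | yes (mid , _ , path) = yes (mid , path)
    ... | no ¬short = no λ { (mid , path) → ¬short (mid , length-bound mid (proj₁ path) , path) }
      where
      length-bound : ∀ mid → Unique (x ∷ (mid ++ [ z ])) → length mid ≤ n
      length-bound mid path! =
        ≤-trans (length-++-≤ˡ mid) (≤-trans (n≤1+n _) (Unique⇒length≤ path!))

    singleton-hSemikernel : ∀ {x₀} → VertexOf G x₀ →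
                            (∀ z → HPathIn HA c G x₀ z → HPathIn HA c G z x₀) →
                            IsHSemikernel HA c G (_≡ x₀)
    singleton-hSemikernel Vx₀ returns =
      (λ { _ refl → Vx₀ }) ,
      (λ { _ _ refl refl x≢y → contradiction refl x≢y }) ,
      λ { z _ _ (_ , refl , x₀⇝z) → _ , refl , returns z x₀⇝z }

arcClass? : {h n k : ℕ} (DA : Fin n → Fin n → Bool) (c : Fin n → Fin n → Fin h)
            (cls : Fin h → Fin k) (i : Fin k) → Decidable (ArcClass DA c cls i)
arcClass? DA c cls i u v = (DA u v ≟ᵇ true) ×-dec (cls (c u v) ≟ᶠ i)

vertexOf? : ∀ {n} {G : Fin n → Fin n → Set} → Decidable G → U.Decidable (VertexOf G)
vertexOf? G? v = any? (λ u → G? v u ⊎-dec G? u v)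

mainTheorem3 :
    (h n k : ℕ) (HA : Fin h → Fin h → Bool) (DA : Fin n → Fin n → Bool)
    (c : Fin n → Fin n → Fin h) (cls : Fin h → Fin k) →
    (∀ v → DA v v ≡ false) →
    (∀ v → ∃ λ u → DA v u ≡ true ⊎ DA u v ≡ true) →
    k ≥ 2 →
    (∀ j → ∃ λ x → cls x ≡ j) →
    (∀ i → ∃ λ u → ∃ λ v → ArcClass DA c cls i u v) →
    (∀ i → TransitiveByHPaths HA c (ArcClass DA c cls i)) →
    (r : Fin k) →
    (¬ (∃ λ (x : ℕ → Fin n) → ∀ i →
          HPathIn HA c (ArcClass DA c cls r) (x i) (x (suc i)) ×
          ¬ HPathIn HA c (ArcClass DA c cls r) (x (suc i)) (x i)))
    × (∃ λ x₀ → VertexOf (ArcClass DA c cls r) x₀ ×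
          IsHSemikernel HA c (ArcClass DA c cls r) (λ v → v ≡ x₀))
mainTheorem3 h n k HA DA c cls _ _ _ _ hasArc transitive r =
  no-infinite-chain , x₀ , Vx₀ , singleton-hSemikernel HA c G Vx₀ returns
  where
  G : Fin n → Fin n → Set
  G = ArcClass DA c cls r

  _⇝_ : Fin n → Fin n → Set
  _⇝_ = HPathIn HA c G

  _⇝?_ : Decidable _⇝_
  _⇝?_ = hPath? HA c G (arcClass? DA c cls r)

  ⇝-irrefl : ∀ {x} → ¬ x ⇝ x
  ⇝-irrefl = hPath-irrefl HA c G

  open StrictOrderOnFin {_≺_ = StrictPart _⇝_} (strictPart-irrefl {P = _⇝_} ⇝-irrefl)
                                               (strictPart-trans {P = _⇝_} ⇝-irrefl (transitive r))

  maximal : ∃ λ x → VertexOf G x × Maximal x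
  maximal with hasArc r
  ... | u , v , uv = ∃-maximal (strictPart? _⇝?_) (vertexOf? (arcClass? DA c cls r))
                       (λ _ x≺y → hPath⇒target-vertexOf HA c G (proj₁ x≺y)) (u , v , inj₁ uv)

  x₀ : Fin n
  x₀ = proj₁ maximal

  Vx₀ : VertexOf G x₀
  Vx₀ = proj₁ (proj₂ maximal)

  returns : ∀ z → x₀ ⇝ z → z ⇝ x₀
  returns z x₀⇝z = decidable-stable (z ⇝? x₀) λ ¬z⇝x₀ → proj₂ (proj₂ maximal) z (x₀⇝z , ¬z⇝x₀)
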